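{- Let $m\geq 1$ and let $D_{18m}=\langle a,b \mid a^{9m}=b^2=(ab)^2=1\rangle$ be the dihedral group of order $18m$. Then the Cayley graph $\mathrm{Cay}(D_{18m},\{b,ab,a^3b\})$ (a $3$-regular graph on $18m$ vertices) has a set of $10m$ vertices on which the induced subgraph is $1$-regular. In particular, it has an induced subgraph of maximum degree $1$ on more than half of its vertices.
   Context: For a group $G$ and an inverse-closed subset $S\subseteq G$ not containing the identity, the Cayley graph $\mathrm{Cay}(G,S)$ has vertex set $G$, with $g$ and $h$ adjacent if and only if $g^{ -1}h\in S$. All groups and graphs are finite. -}

module Defs where

open import Data.Nat using (ℕ; zero; suc; _+_; _*_; _∸_; NonZero)
open import Data.Nat.DivMod using (_%_; m%n<n)
open import Data.Nat.Properties using (m*n≢0)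
open import Data.Fin using (Fin; toℕ; fromℕ<)
open import Data.Bool using (Bool; true; false; _xor_)
open import Data.Product using (_×_; _,_; Σ; ∃-syntax)
open import Data.Sum using (_⊎_)
open import Data.List using (List; length)
open import Data.List.Membership.Propositional using (_∈_)
open import Data.List.Relation.Unary.Unique.Propositional using (Unique)
open import Relation.Binary.PropositionalEquality using (_≡_)

instance
  nz9m : ∀ {m} → .{{NonZero m}} → NonZero (9 * m)
  nz9m {m} {{p}} = m*n≢0 9 m {{_}} {{p}}

-- The dihedral group of order 2n, D_{2n} = ⟨ a , b ∣ a^n = b^2 = (ab)^2 = 1 ⟩,
-- realised concretely: the pair (i , e) stands for the element a^i b^e
-- (i ∈ ℤ/nℤ, e = true meaning b^1, e = false meaning b^0).
-- Using b a = a⁻¹ b one gets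
--   (a^i b^e)(a^j b^f) = a^(i + (-1)^e j) b^(e + f).
module Dihedral (n : ℕ) .{{_ : NonZero n}} where

  _⊕_ : Fin n → Fin n → Fin n
  i ⊕ j = fromℕ< (m%n<n (toℕ i + toℕ j) n)

  ⊝_ : Fin n → Fin n
  ⊝ i = fromℕ< (m%n<n (n ∸ toℕ i) n)

  fromℕmod : ℕ → Fin n
  fromℕmod k = fromℕ< (m%n<n k n)

  D : Set
  D = Fin n × Bool

  _·_ : D → D → D
  (i , false) · (j , f) = (i ⊕ j , f)
  (i , true)  · (j , f) = (i ⊕ (⊝ j) , true xor f)

  inv : D → D
  inv (i , false) = (⊝ i , false)
  inv (i , true)  = (i , true)

  aᵏb : ℕ → D
  aᵏb k = (fromℕmod k , true)

  CayAdj : (D → Set) → D → D → Set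
  CayAdj S g h = S (inv g · h)

  S₃ : D → Set
  S₃ x = (x ≡ aᵏb 0) ⊎ ((x ≡ aᵏb 1) ⊎ (x ≡ aᵏb 3))

  Adj : D → D → Set
  Adj = CayAdj S₃

InducedOneRegular : {V : Set} → (V → V → Set) → List V → Set
InducedOneRegular {V} Adj L =
  ∀ v → v ∈ L → ∃[ w ] (w ∈ L × Adj v w × (∀ u → u ∈ L → Adj v u → u ≡ w))

module Submission where

-- The chosen vertex set is 9-periodic.  Writing a^i and a^i b for the
-- elements of D_{18m} (i ∈ ℤ/9m), we take the rotations a^i with
-- i mod 9 ∈ {0,2,3,5,6} and the reflections a^i b with i mod 9 ∈ {1,2,4,7,8}:
-- five of each in every block of 9 exponents, 10m vertices in total.
--
-- The Cayley graph is bipartite: a^i is adjacent exactly to the reflections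
-- a^(i+d) b with d ∈ {0,1,3} (the exponents of b, ab, a³b).  Since 9 ∣ 9m an
-- edge shifts residues mod 9 by d, so the induced subgraph is governed by a
-- finite check on residues: every selected rotation residue r has exactly one
-- d with r + d a selected reflection residue, and this matching is a
-- bijection between the two residue classes.

open import Defs using (module Dihedral; InducedOneRegular)
open import Data.Nat using (ℕ; suc; _+_; _*_; _∸_; _≤_; z≤n; s≤s; NonZero)
open import Data.Nat.Properties
  using (+-comm; +-assoc; *-comm; m+[n∸m]≡n; m∸n+n≡m; m∸[m∸n]≡n; m∸n≤m; <⇒≤; ≤-trans; m≤m*n)
open import Data.Nat.DivMod
  using (_%_; %-distribˡ-+; m%n%n≡m%n; [m+n]%n≡m%n; m%n≤n; m<n⇒m%n≡m; m∣n⇒o%n%m≡o%m; %-remove-+ˡ)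
open import Data.Nat.Divisibility using (_∣_; m∣m*n)
open import Data.Fin using (Fin; toℕ; cast; combine)
open import Data.Fin.Properties
  using (toℕ-fromℕ<; toℕ-injective; toℕ<n; toℕ-cast; cast-involutive; toℕ-combine; combine-injective; combine-surjective)
open import Data.Bool using (Bool; true; false; T)
open import Data.Unit using (tt)
open import Data.Product using (_×_; _,_; proj₁; proj₂; ∃-syntax)
open import Data.Sum using (inj₁; inj₂)
open import Data.List using (List; []; _∷_; length; map; cartesianProduct; allFin; filter)
open import Data.List.Properties using (length-map; length-++; length-tabulate)
open import Data.List.Membership.Propositional using (_∈_)
open import Data.List.Membership.Propositional.Properties
  using (∈-map⁺; ∈-map⁻; ∈-cartesianProduct⁺; ∈-cartesianProduct⁻; ∈-allFin; ∈-filter⁺; ∈-filter⁻)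
open import Data.List.Relation.Unary.Any using (here; there)
open import Data.List.Relation.Unary.All using ([]; _∷_)
open import Data.List.Relation.Unary.AllPairs using ([]; _∷_)
open import Data.List.Relation.Unary.Unique.Propositional using (Unique)
open import Data.List.Relation.Unary.Unique.Propositional.Properties
  using (map⁺; cartesianProduct⁺; allFin⁺; filter⁺)
open import Relation.Nullary.Decidable using (Dec; T?)
open import Relation.Binary.PropositionalEquality
  using (_≡_; refl; sym; trans; cong; cong₂; subst; module ≡-Reasoning)

infix 4 _≡_mod_
_≡_mod_ : ℕ → ℕ → (k : ℕ) → .{{NonZero k}} → Set
x ≡ y mod k = x % k ≡ y % k

module _ {k : ℕ} .{{_ : NonZero k}} where

  +-congʳ-mod : ∀ {x y} c → x ≡ y mod k → x + c ≡ y + c mod k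
  +-congʳ-mod {x} {y} c x≡y = begin
    (x + c) % k             ≡⟨ %-distribˡ-+ x c k ⟩
    (x % k + c % k) % k     ≡⟨ cong (λ z → (z + c % k) % k) x≡y ⟩
    (y % k + c % k) % k     ≡⟨ sym (%-distribˡ-+ y c k) ⟩
    (y + c) % k             ∎
    where open ≡-Reasoning

  +-congˡ-mod : ∀ {x y} c → x ≡ y mod k → c + x ≡ c + y mod k
  +-congˡ-mod {x} {y} c x≡y =
    trans (cong (_% k) (+-comm c x)) (trans (+-congʳ-mod c x≡y) (cong (_% k) (+-comm y c)))

  %-mod : ∀ x → x % k ≡ x mod k
  %-mod x = m%n%n≡m%n x k

  +-+-mod : ∀ x {a c} → a + c ≡ k → x + a + c ≡ x mod k
  +-+-mod x {a} {c} a+c≡k =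
    trans (cong (_% k) (trans (+-assoc x a c) (cong (x +_) a+c≡k))) ([m+n]%n≡m%n x k)

  transpose-mod : ∀ {x y d} → d ≤ k → x + d ≡ y mod k → x ≡ y + (k ∸ d) mod k
  transpose-mod {x} {d = d} d≤k x+d≡y =
    trans (sym (+-+-mod x (m+[n∸m]≡n d≤k))) (+-congʳ-mod (k ∸ d) x+d≡y)

  +-cancelʳ-mod : ∀ {x y} c → x + c ≡ y + c mod k → x ≡ y mod k
  +-cancelʳ-mod {x} {y} c x+c≡y+c =
    trans (transpose-mod (m%n≤n c k) x+r≡y+r) (+-+-mod y (m+[n∸m]≡n (m%n≤n c k)))
    where
    x+r≡y+r : x + c % k ≡ y + c % k mod k
    x+r≡y+r = trans (+-congˡ-mod x (%-mod c)) (trans x+c≡y+c (sym (+-congˡ-mod y (%-mod c))))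

  mod-divisor : ∀ {d x y} .{{_ : NonZero d}} → d ∣ k → x ≡ y mod k → x ≡ y mod d
  mod-divisor {d} {x} {y} d∣k x≡y =
    trans (sym (m∣n⇒o%n%m≡o%m d k x d∣k)) (trans (cong (_% d) x≡y) (m∣n⇒o%n%m≡o%m d k y d∣k))

module ModularFin (n : ℕ) .{{_ : NonZero n}} where
  open Dihedral n

  toℕ-fromℕmod : ∀ x → toℕ (fromℕmod x) ≡ x mod n
  toℕ-fromℕmod x = trans (cong (_% n) (toℕ-fromℕ< _)) (%-mod x)

  toℕ-injective-mod : ∀ {i j : Fin n} → toℕ i ≡ toℕ j mod n → i ≡ j
  toℕ-injective-mod {i} {j} i≡j =
    toℕ-injective (trans (sym (m<n⇒m%n≡m (toℕ<n i))) (trans i≡j (m<n⇒m%n≡m (toℕ<n j))))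

  ⊕-comm : ∀ i j → i ⊕ j ≡ j ⊕ i
  ⊕-comm i j = cong fromℕmod (+-comm (toℕ i) (toℕ j))

  toℕ-⊕⊝ : ∀ i j → toℕ (i ⊕ (⊝ j)) ≡ toℕ i + (n ∸ toℕ j) mod n
  toℕ-⊕⊝ i j =
    trans (toℕ-fromℕmod (toℕ i + toℕ (⊝ j))) (+-congˡ-mod (toℕ i) (toℕ-fromℕmod (n ∸ toℕ j)))

  ⊕⊝-fromℕmod⁺ : ∀ {i j d} → toℕ i ≡ toℕ j + d mod n → i ⊕ (⊝ j) ≡ fromℕmod d
  ⊕⊝-fromℕmod⁺ {i} {j} {d} i≡j+d =
    toℕ-injective-mod (trans (toℕ-⊕⊝ i j) (trans i-j≡d (sym (toℕ-fromℕmod d))))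
    where
    i-j≡d : toℕ i + (n ∸ toℕ j) ≡ d mod n
    i-j≡d = trans (+-congʳ-mod (n ∸ toℕ j) i≡j+d)
                  (trans (cong (λ z → (z + (n ∸ toℕ j)) % n) (+-comm (toℕ j) d))
                         (+-+-mod d (m+[n∸m]≡n (<⇒≤ (toℕ<n j)))))

  ⊕⊝-fromℕmod⁻ : ∀ {i j d} → i ⊕ (⊝ j) ≡ fromℕmod d → toℕ i ≡ toℕ j + d mod n
  ⊕⊝-fromℕmod⁻ {i} {j} {d} i-j≡d =
    trans (transpose-mod (m∸n≤m n (toℕ j)) i+[n∸j]≡d)
          (cong (_% n) (trans (cong (d +_) (m∸[m∸n]≡n (<⇒≤ (toℕ<n j)))) (+-comm d (toℕ j))))
    where
    i+[n∸j]≡d : toℕ i + (n ∸ toℕ j) ≡ d mod n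
    i+[n∸j]≡d = trans (sym (toℕ-⊕⊝ i j)) (trans (cong (λ z → toℕ z % n) i-j≡d) (toℕ-fromℕmod d))

data Generator : Set where
  b ab a³b : Generator

exponent : Generator → ℕ
exponent b   = 0
exponent ab  = 1
exponent a³b = 3

exponent≤9 : ∀ g → exponent g ≤ 9
exponent≤9 b   = z≤n
exponent≤9 ab  = s≤s z≤n
exponent≤9 a³b = s≤s (s≤s (s≤s z≤n))

module Neighbours (n : ℕ) .{{_ : NonZero n}} where
  open Dihedral n
  open ModularFin n

  S₃-intro : ∀ g → S₃ (aᵏb (exponent g))
  S₃-intro b   = inj₁ refl
  S₃-intro ab  = inj₂ (inj₁ refl)
  S₃-intro a³b = inj₂ (inj₂ refl)

  S₃-elim : ∀ {x} → S₃ x → ∃[ g ] x ≡ aᵏb (exponent g)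
  S₃-elim (inj₁ x≡b)          = b , x≡b
  S₃-elim (inj₂ (inj₁ x≡ab))  = ab , x≡ab
  S₃-elim (inj₂ (inj₂ x≡a³b)) = a³b , x≡a³b

  -- a^i and a^j b differ by the generator g: (a^i)⁻¹ a^j b = a^(exponent g) b,
  -- i.e. j ≡ i + exponent g in ℤ/n.
  Joined : Fin n → Fin n → Generator → Set
  Joined i j g = toℕ j ≡ toℕ i + exponent g mod n

  rotation-adj⁺ : ∀ {i j} g → Joined i j g → Adj (i , false) (j , true)
  rotation-adj⁺ {i} {j} g joined =
    subst S₃ (cong (_, true) (sym (trans (⊕-comm (⊝ i) j) (⊕⊝-fromℕmod⁺ joined)))) (S₃-intro g)

  rotation-adj⁻ : ∀ {i j f} → Adj (i , false) (j , f) → f ≡ true × ∃[ g ] Joined i j g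
  rotation-adj⁻ {i} {j} adj with S₃-elim adj
  ... | g , eq = cong proj₂ eq , g , ⊕⊝-fromℕmod⁻ (trans (⊕-comm j (⊝ i)) (cong proj₁ eq))

  reflection-adj⁺ : ∀ {i j} g → Joined i j g → Adj (j , true) (i , false)
  reflection-adj⁺ g joined = subst S₃ (cong (_, true) (sym (⊕⊝-fromℕmod⁺ joined))) (S₃-intro g)

  reflection-adj⁻ : ∀ {i j f} → Adj (j , true) (i , f) → f ≡ false × ∃[ g ] Joined i j g
  reflection-adj⁻ {f = false} adj with S₃-elim adj
  ... | g , eq = refl , g , ⊕⊝-fromℕmod⁻ (cong proj₁ eq)
  reflection-adj⁻ {f = true} adj with S₃-elim adj
  ... | g , ()

-- Residues modulo 9.  (The NonZero 9 instance is given explicitly: instance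
-- search would also try to read the literal 9 as 9 * m.)
nonZero-9 : NonZero 9
nonZero-9 = _

residue : ℕ → ℕ
residue x = _%_ x 9 {{nonZero-9}}

selected : Bool → ℕ → Bool
selected false 0 = true
selected false 2 = true
selected false 3 = true
selected false 5 = true
selected false 6 = true
selected true  1 = true
selected true  2 = true
selected true  4 = true
selected true  7 = true
selected true  8 = true
selected _     _ = false

-- The matching between selected residues: rotation residue r is paired with
-- reflection residue r + exponent (rotPartner r), and reflection residue t
-- with rotation residue t - exponent (refPartner t).  Off the selected
-- residues the value is irrelevant.
rotPartner : ℕ → Generator
rotPartner 0 = ab
rotPartner 2 = b
rotPartner 3 = ab
rotPartner 5 = a³b
rotPartner 6 = ab
rotPartner _ = b

refPartner : ℕ → Generator
refPartner 1 = ab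
refPartner 2 = b
refPartner 4 = ab
refPartner 7 = ab
refPartner 8 = a³b
refPartner _ = b

rotPartner-selected : ∀ r → T (selected false r) →
  T (selected true (residue (r + exponent (rotPartner r))))
rotPartner-selected 0 _ = tt
rotPartner-selected 2 _ = tt
rotPartner-selected 3 _ = tt
rotPartner-selected 5 _ = tt
rotPartner-selected 6 _ = tt
rotPartner-selected 1 ()
rotPartner-selected 4 ()
rotPartner-selected 7 ()
rotPartner-selected 8 ()
rotPartner-selected (suc (suc (suc (suc (suc (suc (suc (suc (suc _))))))))) ()

refPartner-selected : ∀ t → T (selected true t) →
  T (selected false (residue (t + (9 ∸ exponent (refPartner t)))))
refPartner-selected 1 _ = tt
refPartner-selected 2 _ = tt
refPartner-selected 4 _ = tt
refPartner-selected 7 _ = tt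
refPartner-selected 8 _ = tt
refPartner-selected 0 ()
refPartner-selected 3 ()
refPartner-selected 5 ()
refPartner-selected 6 ()
refPartner-selected (suc (suc (suc (suc (suc (suc (suc (suc (suc _))))))))) ()

edge-matched : ∀ r g → T (selected false r) → T (selected true (residue (r + exponent g))) →
  g ≡ rotPartner r × g ≡ refPartner (residue (r + exponent g))
edge-matched 0 ab  _ _ = refl , refl
edge-matched 2 b   _ _ = refl , refl
edge-matched 3 ab  _ _ = refl , refl
edge-matched 5 a³b _ _ = refl , refl
edge-matched 6 ab  _ _ = refl , refl
edge-matched 0 b   _ ()
edge-matched 0 a³b _ ()
edge-matched 2 ab  _ ()
edge-matched 2 a³b _ ()
edge-matched 3 b   _ ()
edge-matched 3 a³b _ ()
edge-matched 5 b   _ ()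
edge-matched 5 ab  _ ()
edge-matched 6 b   _ ()
edge-matched 6 a³b _ ()
edge-matched 1 _ ()
edge-matched 4 _ ()
edge-matched 7 _ ()
edge-matched 8 _ ()
edge-matched (suc (suc (suc (suc (suc (suc (suc (suc (suc _))))))))) _ ()

length-cartesianProduct : ∀ {A B : Set} (xs : List A) (ys : List B) →
  length (cartesianProduct xs ys) ≡ length xs * length ys
length-cartesianProduct []       ys = refl
length-cartesianProduct (x ∷ xs) ys =
  trans (length-++ (map (x ,_) ys))
        (cong₂ _+_ (length-map (x ,_) ys) (length-cartesianProduct xs ys))

SelectedResidue : Fin 9 × Bool → Set
SelectedResidue (o , e) = T (selected e (toℕ o))

selectedResidue? : (p : Fin 9 × Bool) → Dec (SelectedResidue p)
selectedResidue? (o , e) = T? (selected e (toℕ o))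

booleans : List Bool
booleans = false ∷ true ∷ []

∈-booleans : ∀ e → e ∈ booleans
∈-booleans false = here refl
∈-booleans true  = there (here refl)

residuePattern : List (Fin 9 × Bool)
residuePattern = filter selectedResidue? (cartesianProduct (allFin 9) booleans)

residuePattern-unique : Unique residuePattern
residuePattern-unique =
  filter⁺ selectedResidue? {cartesianProduct (allFin 9) booleans} (cartesianProduct⁺ (allFin⁺ 9) (((λ ()) ∷ []) ∷ [] ∷ []))

residuePattern-length : length residuePattern ≡ 10
residuePattern-length = refl

module ChosenVertices (m : ℕ) .{{_ : NonZero m}} where
  open Dihedral (9 * m)

  Selected : D → Set
  Selected (i , e) = T (selected e (residue (toℕ i)))

  block : Fin m → Fin 9 → Fin (9 * m)
  block k o = cast (*-comm m 9) (combine k o)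

  residue-block : ∀ k o → residue (toℕ (block k o)) ≡ toℕ o
  residue-block k o = begin
    residue (toℕ (block k o))      ≡⟨ cong residue (trans (toℕ-cast _ (combine k o)) (toℕ-combine k o)) ⟩
    residue (9 * toℕ k + toℕ o)    ≡⟨ %-remove-+ˡ (toℕ o) {{nonZero-9}} (m∣m*n (toℕ k)) ⟩
    residue (toℕ o)                ≡⟨ m<n⇒m%n≡m {{nonZero-9}} (toℕ<n o) ⟩
    toℕ o                          ∎
    where open ≡-Reasoning

  block-injective : ∀ {k o k′ o′} → block k o ≡ block k′ o′ → k ≡ k′ × o ≡ o′
  block-injective {k} {o} {k′} {o′} eq = combine-injective k o k′ o′
    (toℕ-injective (trans (sym (toℕ-cast _ (combine k o))) (trans (cong toℕ eq) (toℕ-cast _ (combine k′ o′)))))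

  block-surjective : ∀ i → ∃[ k ] ∃[ o ] block k o ≡ i
  block-surjective i with combine-surjective (cast (*-comm 9 m) i)
  ... | k , o , eq = k , o , trans (cong (cast (*-comm m 9)) eq) (cast-involutive (*-comm m 9) (*-comm 9 m) i)

  place : Fin m × (Fin 9 × Bool) → D
  place (k , (o , e)) = (block k o , e)

  place-injective : ∀ {p q} → place p ≡ place q → p ≡ q
  place-injective {k , (o , e)} {k′ , (o′ , e′)} eq
    with block-injective (cong proj₁ eq) | cong proj₂ eq
  ... | refl , refl | refl = refl

  chosen : List D
  chosen = map place (cartesianProduct (allFin m) residuePattern)

  chosen-unique : Unique chosen
  chosen-unique = map⁺ place-injective (cartesianProduct⁺ (allFin⁺ m) residuePattern-unique)

  chosen-length : length chosen ≡ 10 * m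
  chosen-length = begin
    length chosen                                           ≡⟨ length-map place (cartesianProduct (allFin m) residuePattern) ⟩
    length (cartesianProduct (allFin m) residuePattern)     ≡⟨ length-cartesianProduct (allFin m) residuePattern ⟩
    length (allFin m) * 10                                  ≡⟨ cong (_* 10) (length-tabulate {n = m} (λ i → i)) ⟩
    m * 10                                                  ≡⟨ *-comm m 10 ⟩
    10 * m                                                  ∎
    where open ≡-Reasoning

  ∈chosen⁻ : ∀ {v} → v ∈ chosen → Selected v
  ∈chosen⁻ v∈ with ∈-map⁻ place v∈
  ... | (k , (o , e)) , p∈ , refl =
    subst (λ r → T (selected e r)) (sym (residue-block k o))
      (proj₂ (∈-filter⁻ selectedResidue? {xs = cartesianProduct (allFin 9) booleans} (proj₂ (∈-cartesianProduct⁻ (allFin m) residuePattern p∈))))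

  ∈chosen⁺ : ∀ v → Selected v → v ∈ chosen
  ∈chosen⁺ (i , e) sel with block-surjective i
  ... | k , o , refl = ∈-map⁺ place (∈-cartesianProduct⁺ (∈-allFin k)
          (∈-filter⁺ selectedResidue? {xs = cartesianProduct (allFin 9) booleans} (∈-cartesianProduct⁺ (∈-allFin o) (∈-booleans e))
            (subst (λ r → T (selected e r)) (residue-block k o) sel)))

module InducedMatching (m : ℕ) .{{_ : NonZero m}} where
  open Dihedral (9 * m)
  open ModularFin (9 * m)
  open Neighbours (9 * m)
  open ChosenVertices m

  -- Since 9 ∣ 9m, an edge shifts residues mod 9 by the generator's exponent.
  joined-mod9 : ∀ i j g → Joined i j g → residue (toℕ j) ≡ residue (toℕ i + exponent g)
  joined-mod9 i j g joined = mod-divisor {d = 9} {{nonZero-9}} (m∣m*n m) joined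

  joined-residue : ∀ i j g → Joined i j g →
    residue (toℕ j) ≡ residue (residue (toℕ i) + exponent g)
  joined-residue i j g joined =
    trans (joined-mod9 i j g joined)
          (sym (+-congʳ-mod {k = 9} {{nonZero-9}} {residue (toℕ i)} {toℕ i} (exponent g)
                            (%-mod {k = 9} {{nonZero-9}} (toℕ i))))

  UniqueChosenNeighbour : D → Set
  UniqueChosenNeighbour v =
    ∃[ w ] (w ∈ chosen × Adj v w × (∀ u → u ∈ chosen → Adj v u → u ≡ w))

  rotation-case : ∀ i → Selected (i , false) → UniqueChosenNeighbour (i , false)
  rotation-case i sel = (j , true) , ∈chosen⁺ (j , true) j-selected , rotation-adj⁺ g joined , unique
    where
    r = residue (toℕ i)
    g = rotPartner r
    j = fromℕmod (toℕ i + exponent g)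

    joined : Joined i j g
    joined = toℕ-fromℕmod (toℕ i + exponent g)

    j-selected : Selected (j , true)
    j-selected = subst (λ t → T (selected true t)) (sym (joined-residue i j g joined)) (rotPartner-selected r sel)

    unique : ∀ u → u ∈ chosen → Adj (i , false) u → u ≡ (j , true)
    unique (j′ , f) u∈ adj with rotation-adj⁻ {i} {j′} {f} adj
    ... | refl , g′ , joined′ =
      cong (_, true) (toℕ-injective-mod {j′} {j} (trans (subst (Joined i j′) g′≡g joined′) (sym joined)))
      where
      g′≡g : g′ ≡ g
      g′≡g = proj₁ (edge-matched r g′ sel
               (subst (λ t → T (selected true t)) (joined-residue i j′ g′ joined′) (∈chosen⁻ u∈)))

  reflection-case : ∀ j → Selected (j , true) → UniqueChosenNeighbour (j , true)
  reflection-case j sel = (i , false) , ∈chosen⁺ (i , false) i-selected , reflection-adj⁺ g joined , unique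
    where
    t = residue (toℕ j)
    g = refPartner t
    e = exponent g
    e≤9m : e ≤ 9 * m
    e≤9m = ≤-trans (exponent≤9 g) (m≤m*n 9 m)
    i = fromℕmod (toℕ j + (9 * m ∸ e))

    joined : Joined i j g
    joined = sym (trans (+-congʳ-mod e (toℕ-fromℕmod (toℕ j + (9 * m ∸ e))))
                        (+-+-mod (toℕ j) (m∸n+n≡m e≤9m)))

    i-selected : Selected (i , false)
    i-selected = subst (λ r → T (selected false r)) (sym i≡t-e) (refPartner-selected t sel)
      where
      i≡t-e : residue (toℕ i) ≡ residue (t + (9 ∸ e))
      i≡t-e = trans (transpose-mod {k = 9} {{nonZero-9}} {toℕ i} {toℕ j} (exponent≤9 g) (sym (joined-mod9 i j g joined)))
                    (+-congʳ-mod {k = 9} {{nonZero-9}} {toℕ j} {t} (9 ∸ e) (sym (%-mod {k = 9} {{nonZero-9}} (toℕ j))))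

    unique : ∀ u → u ∈ chosen → Adj (j , true) u → u ≡ (i , false)
    unique (i′ , f) u∈ adj with reflection-adj⁻ {i′} {j} {f} adj
    ... | refl , g′ , joined′ =
      cong (_, false) (toℕ-injective-mod (+-cancelʳ-mod e (trans (sym (subst (Joined i′ j) g′≡g joined′)) joined)))
      where
      g′≡g : g′ ≡ g
      g′≡g = trans (proj₂ (edge-matched (residue (toℕ i′)) g′ (∈chosen⁻ u∈)
                     (subst (λ s → T (selected true s)) (joined-residue i′ j g′ joined′) sel)))
                   (cong refPartner (sym (joined-residue i′ j g′ joined′)))

  one-regular : InducedOneRegular Adj chosen
  one-regular (i , false) v∈ = rotation-case i (∈chosen⁻ v∈)
  one-regular (j , true)  v∈ = reflection-case j (∈chosen⁻ v∈)

mainTheorem2 : (m : ℕ) → .{{_ : NonZero m}} →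
    ∃[ L ] (Unique L × length L ≡ 10 * m
            × InducedOneRegular (Dihedral.Adj (9 * m)) L)
mainTheorem2 m = chosen , chosen-unique , chosen-length , one-regular
  where
  open ChosenVertices m
  open InducedMatching m
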